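{- Let $H$ be a graph not containing $K_4$ as a subgraph, and let $f:G_3\to H$ be a graph homomorphism. Then $f$ is injective.
   Context: Graphs are simple and undirected (no loops). For $n\ge 1$, $G_n$ is the graph with vertex set $\{v_1,v_2\}\cup\{a_i:i\in[n]\}\cup\{b_i:i\in[n]\}$ and edges $(v_1,a_i)$, $(v_2,b_i)$, $(a_i,b_i)$ for $i\in[n]$, and $(a_i,a_{i+1})$, $(b_i,b_{i+1})$, $(a_{i+1},b_i)$ for $i\in[n-1]$. -}

module Defs where

open import Level using (Level; suc; _⊔_)
open import Data.Nat using (ℕ)
open import Data.Fin using (Fin; toℕ)
open import Data.Nat using (_+_)
open import Data.Product using (Σ; ∃; _×_; _,_)
open import Data.Sum using (_⊎_)
open import Relation.Nullary using (¬_)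
open import Relation.Binary.PropositionalEquality using (_≡_)

record Graph (v e : Level) : Set (suc (v ⊔ e)) where
  field
    V     : Set v
    Adj   : V → V → Set e
    Adj-sym : ∀ {x y} → Adj x y → Adj y x
    irrefl : ∀ {x} → ¬ Adj x x
open Graph public

IsHom : ∀ {v₁ e₁ v₂ e₂} (G : Graph v₁ e₁) (H : Graph v₂ e₂) →
        (V G → V H) → Set (v₁ ⊔ e₁ ⊔ e₂)
IsHom G H f = ∀ {x y} → Adj G x y → Adj H (f x) (f y)

-- H contains K₄ as a subgraph: four pairwise distinct, pairwise adjacent vertices
-- (adjacency already forces distinctness since graphs are loopless).
ContainsK4 : ∀ {v e} → Graph v e → Set (v ⊔ e)
ContainsK4 H =
  Σ (V H) λ w → Σ (V H) λ x → Σ (V H) λ y → Σ (V H) λ z →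
    Adj H w x × Adj H w y × Adj H w z × Adj H x y × Adj H x z × Adj H y z

Injective : ∀ {a b} {A : Set a} {B : Set b} → (A → B) → Set (a ⊔ b)
Injective f = ∀ {x y} → f x ≡ f y → x ≡ y

-- Vertices of G_n: v₁, v₂, a_i, b_i  (i ∈ [n], indexed by Fin n, i.e. i-1).
data GV (n : ℕ) : Set where
  v₁ v₂ : GV n
  a b   : Fin n → GV n

data GE (n : ℕ) : GV n → GV n → Set where
  v₁a  : ∀ i → GE n v₁ (a i)
  v₂b  : ∀ i → GE n v₂ (b i)
  ab   : ∀ i → GE n (a i) (b i)
  aa   : ∀ i j → toℕ j ≡ toℕ i + 1 → GE n (a i) (a j)
  bb   : ∀ i j → toℕ j ≡ toℕ i + 1 → GE n (b i) (b j)
  a'b  : ∀ i j → toℕ j ≡ toℕ i + 1 → GE n (a j) (b i)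

GAdj : ∀ n → GV n → GV n → Set
GAdj n x y = GE n x y ⊎ GE n y x

open import Data.Sum using (inj₁; inj₂)
open import Data.Nat.Properties using (1+n≢n; +-comm)
open import Relation.Binary.PropositionalEquality using (trans; sym)

private
  noLoop : ∀ {n} {x : GV n} → ¬ GE n x x
  noLoop (aa i .i p) = 1+n≢n (sym (trans p (+-comm (toℕ i) 1)))
  noLoop (bb i .i p) = 1+n≢n (sym (trans p (+-comm (toℕ i) 1)))

G : ℕ → Graph Level.zero Level.zero
G n = record
  { V = GV n
  ; Adj = GAdj n
  ; Adj-sym = λ { (inj₁ e) → inj₂ e ; (inj₂ e) → inj₁ e }
  ; irrefl = λ { (inj₁ e) → noLoop e ; (inj₂ e) → noLoop e }
  }

{-# OPTIONS --safe #-}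
-- Two adjacent vertices of G₃ cannot be identified by a homomorphism, since H is
-- loopless.  For every other pair u ≠ w the neighbourhoods of u and w together
-- contain a triangle; identifying u and w makes the common image adjacent to all
-- three images of that triangle, which is a K₄ in H.
module Submission where

open import Defs
open import Level using (Level; _⊔_)
open import Data.Bool using (T)
open import Data.Empty using (⊥-elim)
open import Data.Fin using (zero; suc; toℕ)
open import Data.Fin.Properties using (_≟_)
open import Data.List using (List; _∷_; _++_; map; allFin)
open import Data.List.Membership.Propositional using (_∈_)
open import Data.List.Membership.Propositional.Properties using (∈-++⁺ˡ; ∈-++⁺ʳ; ∈-map⁺; ∈-allFin)
open import Data.List.Relation.Unary.All as All using ([]; _∷_)
open import Data.List.Relation.Unary.AllPairs using (AllPairs; []; _∷_)
open import Data.List.Relation.Unary.Any using (here; there)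
open import Data.Maybe using (Maybe; just; nothing; _<∣>_; _>>=_; is-just; to-witness-T)
import Data.Maybe as Maybe
import Data.Nat as ℕ
open import Data.Nat using (_+_)
open import Data.Product using (_×_; _,_)
open import Data.Sum using (_⊎_; inj₁; inj₂)
open import Relation.Binary.PropositionalEquality using (_≡_; _≢_; refl; sym; subst)
open import Relation.Nullary using (¬_; yes; no)
open import Relation.Nullary.Decidable using (dec⇒maybe)

Triangle : ∀ {v e} (G : Graph v e) → V G → V G → V G → Set e
Triangle G x y z = Adj G x y × Adj G x z × Adj G y z

Dominates : ∀ {v e} (G : Graph v e) → V G → V G → V G → Set e
Dominates G u w x = Adj G u x ⊎ Adj G w x

data Unmergeable {v e} (G : Graph v e) (u w : V G) : Set (v ⊔ e) where
  adjacent           : Adj G u w → Unmergeable G u w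
  dominated-triangle : ∀ {x y z} → Triangle G x y z →
                       Dominates G u w x → Dominates G u w y → Dominates G u w z →
                       Unmergeable G u w

module _ {vG eG vH eH} {G : Graph vG eG} (H : Graph vH eH) {f : V G → V H} (hom : IsHom G H f)
         where

  dominated⇒image-adjacent : ∀ {u w x} → f u ≡ f w → Dominates G u w x → Adj H (f u) (f x)
  dominated⇒image-adjacent fu≡fw (inj₁ ux) = hom ux
  dominated⇒image-adjacent {x = x} fu≡fw (inj₂ wx) =
    subst (λ c → Adj H c (f x)) (sym fu≡fw) (hom wx)

  unmergeable⇒images-distinct : ¬ ContainsK4 H → ∀ {u w} → Unmergeable G u w → f u ≢ f w
  unmergeable⇒images-distinct _ {u} (adjacent uw) fu≡fw =
    irrefl H (subst (Adj H (f u)) (sym fu≡fw) (hom uw))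
  unmergeable⇒images-distinct K4-free {u} {w} (dominated-triangle (xy , xz , yz) dx dy dz) fu≡fw =
    K4-free (_ , _ , _ , _ , image dx , image dy , image dz , hom xy , hom xz , hom yz)
    where
      image : ∀ {x} → Dominates G u w x → Adj H (f u) (f x)
      image = dominated⇒image-adjacent fu≡fw

module _ {ℓ r} {A : Set ℓ} {R : A → A → Set r} where

  AllPairs-∈⇒≡⊎related : ∀ {xs x y} → AllPairs R xs → x ∈ xs → y ∈ xs → x ≡ y ⊎ R x y ⊎ R y x
  AllPairs-∈⇒≡⊎related (_  ∷ _)  (here refl) (here refl) = inj₁ refl
  AllPairs-∈⇒≡⊎related (Rx ∷ _)  (here refl) (there y∈) = inj₂ (inj₁ (All.lookup Rx y∈))
  AllPairs-∈⇒≡⊎related (Rx ∷ _)  (there x∈) (here refl) = inj₂ (inj₂ (All.lookup Rx x∈))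
  AllPairs-∈⇒≡⊎related (_  ∷ Rs) (there x∈) (there y∈) = AllPairs-∈⇒≡⊎related Rs x∈ y∈

vertices : ∀ n → List (GV n)
vertices n = v₁ ∷ v₂ ∷ map a (allFin n) ++ map b (allFin n)

∈-vertices : ∀ {n} (x : GV n) → x ∈ vertices n
∈-vertices v₁    = here refl
∈-vertices v₂    = there (here refl)
∈-vertices (a i) = there (there (∈-++⁺ˡ (∈-map⁺ a (∈-allFin i))))
∈-vertices {n} (b i) = there (there (∈-++⁺ʳ (map a (allFin n)) (∈-map⁺ b (∈-allFin i))))

edge? : ∀ {n} (x y : GV n) → Maybe (GE n x y)
edge? v₁    (a i) = just (v₁a i)
edge? v₂    (b i) = just (v₂b i)
edge? (a i) (a j) = Maybe.map (aa i j) (dec⇒maybe (toℕ j ℕ.≟ toℕ i + 1))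
edge? (b i) (b j) = Maybe.map (bb i j) (dec⇒maybe (toℕ j ℕ.≟ toℕ i + 1))
edge? (a i) (b j) with i ≟ j
... | yes refl = just (ab i)
... | no _     = Maybe.map (a'b j i) (dec⇒maybe (toℕ i ℕ.≟ toℕ j + 1))
edge? _     _     = nothing

adjacent? : ∀ {n} (x y : GV n) → Maybe (GAdj n x y)
adjacent? x y = Maybe.map inj₁ (edge? x y) <∣> Maybe.map inj₂ (edge? y x)

dominated-triangle? : ∀ {n} (u w x y z : GV n) → Maybe (Unmergeable (G n) u w)
dominated-triangle? {n} u w x y z = do
  xy ← adjacent? x y
  xz ← adjacent? x z
  yz ← adjacent? y z
  dx ← dominates? x
  dy ← dominates? y
  dz ← dominates? z
  just (dominated-triangle (xy , xz , yz) dx dy dz)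
  where
    dominates? : ∀ t → Maybe (Dominates (G n) u w t)
    dominates? t = Maybe.map inj₁ (adjacent? u t) <∣> Maybe.map inj₂ (adjacent? w t)

edge : ∀ {n} {u w : GV n} {_ : T (is-just (adjacent? u w))} → Unmergeable (G n) u w
edge {u = u} {w} {found} = adjacent (to-witness-T (adjacent? u w) found)

via : ∀ {n} {u w : GV n} (x y z : GV n) {_ : T (is-just (dominated-triangle? u w x y z))} →
      Unmergeable (G n) u w
via {u = u} {w} x y z {found} = to-witness-T (dominated-triangle? u w x y z) found

pattern a₁ = a zero
pattern a₂ = a (suc zero)
pattern a₃ = a (suc (suc zero))
pattern b₁ = b zero
pattern b₂ = b (suc zero)
pattern b₃ = b (suc (suc zero))

-- Row k pairs the k-th vertex of v₁ v₂ a₁ a₂ a₃ b₁ b₂ b₃ with the later ones;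
-- via x y z names the dominated triangle, and every entry is checked by evaluation.
G₃-pairwise-unmergeable : AllPairs (Unmergeable (G 3)) (vertices 3)
G₃-pairwise-unmergeable =
    (via a₁ a₂ b₁ ∷ edge ∷ edge ∷ edge ∷ via a₂ a₃ b₂ ∷ via a₁ a₂ b₁ ∷ via a₂ a₃ b₂ ∷ [])
  ∷ (via a₂ b₁ b₂ ∷ via a₃ b₂ b₃ ∷ via a₂ b₁ b₂ ∷ edge ∷ edge ∷ edge ∷ [])
  ∷ (edge ∷ via a₂ b₁ b₂ ∷ edge ∷ via v₁ a₂ a₃ ∷ via v₁ a₂ a₃ ∷ [])
  ∷ (edge ∷ edge ∷ edge ∷ via v₂ b₁ b₂ ∷ [])
  ∷ (via v₁ a₁ a₂ ∷ edge ∷ edge ∷ [])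
  ∷ (edge ∷ via a₂ a₃ b₂ ∷ [])
  ∷ (edge ∷ [])
  ∷ []
  ∷ []

lemma5p2 : ∀ {v e : Level} (H : Graph v e) → ¬ ContainsK4 H →
           (f : V (G 3) → V H) → IsHom (G 3) H f → Injective f
lemma5p2 H K4-free f hom {x} {y} fx≡fy
  with AllPairs-∈⇒≡⊎related G₃-pairwise-unmergeable (∈-vertices x) (∈-vertices y)
... | inj₁ x≡y        = x≡y
... | inj₂ (inj₁ x⋈y) = ⊥-elim (unmergeable⇒images-distinct H hom K4-free x⋈y fx≡fy)
... | inj₂ (inj₂ y⋈x) = ⊥-elim (unmergeable⇒images-distinct H hom K4-free y⋈x (sym fx≡fy))
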